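{- Let $f:\mathbb{N}\to\mathbb{N}$ be defined by $f(0)=0$ and, for $n\ge 1$, $f(n)$ is the least natural number such that $f(n)\notin\{f(0),\ldots,f(n-1)\}$ and $\sum_{1\le i\le n} f(i)$ is divisible by $n$. Let $z:\mathbb{N}\to\mathbb{N}$ be defined by $z(0)=0$ and, for $n\ge 1$, $z(n)$ is the least natural number such that $z(n)\notin\{z(0),\ldots,z(n-1)\}$ and $\sum_{2\le i\le n} z(i)$ is divisible by $n+1$ (an empty sum being $0$). Then for all $n\ge 0$, $$z(n)\in\{f(n),\ f(n)+n,\ f(n)+1,\ f(n)-n\}.$$
   Context: $\mathbb{N}=\{0,1,2,\ldots\}$. The sequence $z$ begins $0,1,3,5,2,8,10,4,13,15,\ldots$ (OEIS A340510). -}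

module Defs where

open import Data.Nat using (ℕ; zero; suc; _+_; _*_)
open import Data.Nat.Properties using (_≟_)
open import Data.Nat.Divisibility using (_∣?_)
open import Data.Bool using (Bool; true; false; if_then_else_; not; _∧_)
open import Data.List using (List; []; _∷_; _++_; [_]; drop)
open import Data.Nat.ListAction using (sum)
open import Data.List.Membership.DecPropositional _≟_ using (_∈?_)
open import Relation.Nullary.Decidable using (⌊_⌋)

search : (ℕ → Bool) → ℕ → ℕ → ℕ
search P zero k = k
search P (suc fuel) k = if P k then k else search P fuel (suc k)

-- Search bound for step n: (n+2)^2.  This is large enough: among the values
-- m < n(n+1) (resp. (n+1)^2) there are n+1 values in each admissible residue
-- class modulo n (resp. n+1), while only n values have been used before, so
-- the least admissible value is found by the search starting from 0.
bound : ℕ → ℕ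
bound n = suc (suc n) * suc (suc n)

-- fNext n L : the value f(n), given L = [f(0), …, f(n-1)].
-- For n ≥ 1: least m ∉ L with n ∣ (f(1)+…+f(n-1)) + m  (note f(0) = 0).
fNext : ℕ → List ℕ → ℕ
fNext zero L = 0
fNext (suc k) L =
  search (λ m → not ⌊ m ∈? L ⌋ ∧ ⌊ suc k ∣? (sum L + m) ⌋) (bound (suc k)) 0

fHist : ℕ → List ℕ
fHist zero = []
fHist (suc n) = fHist n ++ [ fNext n (fHist n) ]

f : ℕ → ℕ
f n = fNext n (fHist n)

-- zNext n L : the value z(n), given L = [z(0), …, z(n-1)].
-- n = 1: the sum over 2 ≤ i ≤ 1 is empty (= 0), so only z(1) ∉ L is required.
-- n ≥ 2: least m ∉ L with (n+1) ∣ (z(2)+…+z(n-1)) + m.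
zNext : ℕ → List ℕ → ℕ
zNext zero L = 0
zNext (suc zero) L = search (λ m → not ⌊ m ∈? L ⌋) (bound 1) 0
zNext (suc (suc k)) L =
  search (λ m → not ⌊ m ∈? L ⌋ ∧ ⌊ suc (suc (suc k)) ∣? (sum (drop 2 L) + m) ⌋)
         (bound (suc (suc k))) 0

zHist : ℕ → List ℕ
zHist zero = []
zHist (suc n) = zHist n ++ [ zNext n (zHist n) ]

z : ℕ → ℕ
z n = zNext n (zHist n)

module Submission where

-- Let c(m) be the least u with m² ≤ u(u + m), i.e. c(m) = ⌈m/φ⌉, and D(m) the least u with
-- m² ≤ u(u + m) + 1. By induction f(1) + … + f(k) = k c(k), so f(k + 1) is the least unused
-- number congruent to c(k) modulo k + 1: it is c(k) when c is flat at k (c(k + 1) = c(k)) and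
-- c(k) + k + 1 when c jumps there. Likewise z(2) + … + z(n − 1) = n (D(n) − 1), and z(n) + 1 is
-- D(n) or D(n) + n + 1 according as D is flat or jumps at n. That the small candidate is already
-- used exactly at the jumps comes from the identity Q(a, a + b) = −Q(b, a) for the form
-- Q(u, m) = u² + um − m², which transfers the threshold conditions at a point to an earlier one.
-- The four cases of the theorem then come from c(m) ≤ D(m + 1) ≤ c(m) + 1 and c(m) < D(m + 2).

open import Data.Bool using (Bool; true; false; not; _∧_)
open import Data.Bool.Properties using (∧-zeroʳ)
open import Data.List using (List; []; _∷_; _++_; [_]; drop; length)
open import Data.List.Properties using (length-++)
open import Data.List.Membership.Propositional using (_∈_; _∉_)
open import Data.List.Membership.Propositional.Properties using (∈-++⁺ˡ; ∈-++⁺ʳ; ∈-++⁻)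
open import Data.List.Relation.Unary.Any using (here)
open import Data.Nat
open import Data.Nat.Divisibility using (_∣_; _∣?_; ∣⇒≤; ∣m+n∣m⇒∣n; m∣m*n)
open import Data.Nat.ListAction using (sum)
open import Data.Nat.ListAction.Properties using (sum-++)
open import Data.Nat.Properties
open import Data.List.Membership.DecPropositional _≟_ using (_∈?_)
open import Data.Nat.Tactic.RingSolver using (solve-∀)
open import Data.Product using (∃-syntax; _×_; _,_; proj₁; proj₂)
import Data.Sum as Sum
open import Data.Sum using (_⊎_; inj₁; inj₂)
open import Function.Base using (_∘_)
open import Function.Bundles using (_⇔_; mk⇔; Equivalence)
open import Relation.Binary.Definitions using (tri<; tri≈; tri>)
open import Relation.Binary.PropositionalEquality
  using (_≡_; _≢_; refl; sym; trans; cong; cong₂; subst; subst₂; module ≡-Reasoning)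
open import Relation.Nullary using (¬_; Dec; yes; no; contradiction)
open import Relation.Nullary.Decidable
  using (⌊_⌋; isYes≗does; dec-true; dec-false; map′; from-yes; from-no)

open import Defs

private variable
  A : Set
  K a b m n r r′ s t t′ u u′ v w x : ℕ
  L : List ℕ
  P : ℕ → Bool

⌊⌋-true : (a? : Dec A) → A → ⌊ a? ⌋ ≡ true
⌊⌋-true a? a = trans (isYes≗does a?) (dec-true a? a)

⌊⌋-false : (a? : Dec A) → ¬ A → ⌊ a? ⌋ ≡ false
⌊⌋-false a? ¬a = trans (isYes≗does a?) (dec-false a? ¬a)

not⌊⌋-true : (a? : Dec A) → not ⌊ a? ⌋ ≡ true → ¬ A
not⌊⌋-true (yes _) ()
not⌊⌋-true (no ¬a) _ = ¬a

not⌊⌋-false : (a? : Dec A) → not ⌊ a? ⌋ ≡ false → A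
not⌊⌋-false (yes a) _ = a
not⌊⌋-false (no _)  ()

a≤b≤1+a⇒b≡a∨b≡1+a : a ≤ b → b ≤ suc a → b ≡ a ⊎ b ≡ suc a
a≤b≤1+a⇒b≡a∨b≡1+a a≤b b≤1+a =
  Sum.map₁ (λ b<1+a → ≤-antisym (≤-pred b<1+a) a≤b) (m≤n⇒m<n∨m≡n b≤1+a)

IsLeast : (ℕ → Bool) → ℕ → Set
IsLeast P r = P r ≡ true × (∀ {u} → u < r → P u ≡ false)

search-isLeast-from : ∀ P fuel s → (∀ {u} → u < s → P u ≡ false) →
                      s ≤ w → w < s + fuel → P w ≡ true → IsLeast P (search P fuel s)
search-isLeast-from {w} P zero s _ s≤w w<s+0 _ =
  contradiction (subst (_≤ w) (sym (+-identityʳ s)) s≤w) (<⇒≱ w<s+0)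
search-isLeast-from {w} P (suc fuel) s below-s s≤w w<s+1+fuel Pw with P s in Ps
... | true  = Ps , below-s
... | false = search-isLeast-from P fuel (suc s) below-1+s s<w (subst (w <_) (+-suc s fuel) w<s+1+fuel) Pw
  where
  s<w : s < w
  s<w = ≤∧≢⇒< s≤w λ { refl → contradiction (trans (sym Ps) Pw) λ () }
  below-1+s : ∀ {u} → u < suc s → P u ≡ false
  below-1+s u<1+s with m<1+n⇒m<n∨m≡n u<1+s
  ... | inj₁ u<s  = below-s u<s
  ... | inj₂ refl = Ps

search-isLeast : ∀ P {fuel} → w < fuel → P w ≡ true → IsLeast P (search P fuel 0)
search-isLeast P = search-isLeast-from P _ 0 (λ ()) z≤n

isLeast-unique : IsLeast P r → IsLeast P r′ → r ≡ r′
isLeast-unique {r = r} {r′ = r′} (Pr , below-r) (Pr′ , below-r′) with <-cmp r r′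
... | tri< r<r′ _ _ = contradiction (trans (sym Pr) (below-r′ r<r′)) λ ()
... | tri≈ _ r≡r′ _ = r≡r′
... | tri> _ _ r′<r = contradiction (trans (sym Pr′) (below-r r′<r)) λ ()

∣-both⇒≤∸ : n ∣ m + u → n ∣ m + v → u < v → n ≤ v ∸ u
∣-both⇒≤∸ {n} {m} {u} {v} n∣m+u n∣m+v u<v =
  ∣⇒≤ {{>-nonZero (m<n⇒0<n∸m u<v)}}
      (∣m+n∣m⇒∣n (subst (n ∣_) m+v≡m+u+[v∸u] n∣m+v) n∣m+u)
  where
  m+v≡m+u+[v∸u] : m + v ≡ m + u + (v ∸ u)
  m+v≡m+u+[v∸u] = trans (cong (m +_) (sym (m+[n∸m]≡n (<⇒≤ u<v)))) (sym (+-assoc m u (v ∸ u)))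

1+K∣K*v+v : suc K ∣ K * v + v
1+K∣K*v+v {K} {v} = subst (suc K ∣_) (+-comm v (K * v)) (m∣m*n v)

residue-unique : suc K ∣ K * v + u → v ≤ K → u < v + suc K → u ≡ v
residue-unique {K} {v} {u} 1+K∣K*v+u v≤K u<v+1+K with <-cmp u v
... | tri< u<v _ _ =
  contradiction (∣-both⇒≤∸ 1+K∣K*v+u 1+K∣K*v+v u<v)
                (<⇒≱ (s≤s (≤-trans (m∸n≤m v u) v≤K)))
... | tri≈ _ u≡v _ = u≡v
... | tri> _ _ v<u =
  contradiction (∣-both⇒≤∸ 1+K∣K*v+v 1+K∣K*v+u v<u) (<⇒≱ (m<n+o⇒m∸n<o u v u<v+1+K))

Admissible : List ℕ → ℕ → ℕ → ℕ → Bool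
Admissible L n s m = not ⌊ m ∈? L ⌋ ∧ ⌊ n ∣? (s + m) ⌋

admissible : m ∉ L → n ∣ s + m → Admissible L n s m ≡ true
admissible {m} {L} {n} {s} m∉L n∣s+m =
  cong₂ _∧_ (cong not (⌊⌋-false (m ∈? L) m∉L)) (⌊⌋-true (n ∣? (s + m)) n∣s+m)

∈⇒¬admissible : m ∈ L → Admissible L n s m ≡ false
∈⇒¬admissible {m} {L} m∈L rewrite ⌊⌋-true (m ∈? L) m∈L = refl

∤⇒¬admissible : ¬ n ∣ s + m → Admissible L n s m ≡ false
∤⇒¬admissible {n} {s} {m} {L} n∤s+m rewrite ⌊⌋-false (n ∣? (s + m)) n∤s+m = ∧-zeroʳ _

module Greedy {L : List ℕ} {K s v B : ℕ}
              (s≡K*v : s ≡ K * v) (v≤K : v ≤ K) (v+1+K<B : v + suc K < B) where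

  private
    only-v-admissible : ∀ {u} → u < v + suc K → u ≢ v → Admissible L (suc K) s u ≡ false
    only-v-admissible {u} u<v+1+K u≢v = ∤⇒¬admissible {L = L} λ 1+K∣s+u →
      u≢v (residue-unique (subst (λ x → suc K ∣ x + u) s≡K*v 1+K∣s+u) v≤K u<v+1+K)

  greedy-fresh : v ∉ L → search (Admissible L (suc K) s) B 0 ≡ v
  greedy-fresh v∉L = isLeast-unique (search-isLeast _ (≤-<-trans (m≤m+n v (suc K)) v+1+K<B) admissible-v)
    (admissible-v , λ u<v → only-v-admissible (<-≤-trans u<v (m≤m+n v (suc K))) (<⇒≢ u<v))
    where
    admissible-v : Admissible L (suc K) s v ≡ true
    admissible-v = admissible {s = s} v∉L (subst (λ x → suc K ∣ x + v) (sym s≡K*v) 1+K∣K*v+v)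

  greedy-taken : v ∈ L → v + suc K ∉ L → search (Admissible L (suc K) s) B 0 ≡ v + suc K
  greedy-taken v∈L v+1+K∉L =
    isLeast-unique (search-isLeast _ v+1+K<B admissible-v+1+K) (admissible-v+1+K , below-v+1+K)
    where
    identity : ∀ K v → suc K * suc v ≡ K * v + (v + suc K)
    identity = solve-∀
    admissible-v+1+K : Admissible L (suc K) s (v + suc K) ≡ true
    admissible-v+1+K = admissible {s = s} v+1+K∉L
      (subst (λ x → suc K ∣ x + (v + suc K)) (sym s≡K*v)
             (subst (suc K ∣_) (identity K v) (m∣m*n (suc v))))
    below-v+1+K : ∀ {u} → u < v + suc K → Admissible L (suc K) s u ≡ false
    below-v+1+K {u} u<v+1+K with u ≟ v
    ... | yes refl = ∈⇒¬admissible {s = s} v∈L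
    ... | no u≢v   = only-v-admissible u<v+1+K u≢v

bound-large : v ≤ K → K ≤ n → v + suc K < bound n
bound-large {v} {K} {n} v≤K K≤n = begin-strict
  v + suc K                                   ≤⟨ +-mono-≤ (≤-trans v≤K K≤n) (s≤s K≤n) ⟩
  n + suc n                                   <⟨ m<m+n (n + suc n) z<s ⟩
  n + suc n + suc (suc (suc (n * n + 2 * n))) ≡⟨ identity n ⟩
  suc (suc n) * suc (suc n)                   ∎
  where
  open ≤-Reasoning
  identity : ∀ n → n + suc n + suc (suc (suc (n * n + 2 * n))) ≡ suc (suc n) * suc (suc n)
  identity = solve-∀

-- Below t u m and Above t u m say Q(u, m) ≤ −t and Q(u, m) ≥ t for Q(u, m) = u² + um − m².
record Below (t u m : ℕ) : Set where
  constructor below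
  field
    below-≤ : u * (u + m) + t ≤ m * m

record Above (t u m : ℕ) : Set where
  constructor above
  field
    above-≤ : m * m + t ≤ u * (u + m)

below? : ∀ t u m → Dec (Below t u m)
below? t u m = map′ below Below.below-≤ (_ ≤? _)

u*[u+m]-mono : u ≤ u′ → u * (u + m) ≤ u′ * (u′ + m)
u*[u+m]-mono {m = m} u≤u′ = *-mono-≤ u≤u′ (+-monoˡ-≤ m u≤u′)

Below-antitone : u ≤ u′ → Below t u′ m → Below t u m
Below-antitone {t = t} u≤u′ (below h) = below (≤-trans (+-monoˡ-≤ t (u*[u+m]-mono u≤u′)) h)

Above-mono : u ≤ u′ → Above t u m → Above t u′ m
Above-mono u≤u′ (above h) = above (≤-trans h (u*[u+m]-mono u≤u′))

Below-weaken : t ≤ t′ → Below t′ u m → Below t u m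
Below-weaken {u = u} {m = m} t≤t′ (below h) = below (≤-trans (+-monoʳ-≤ (u * (u + m)) t≤t′) h)

Below⇒< : 1 ≤ t → Below t u m → u < m
Below⇒< {u = u} {m = m} 1≤t (below h) = ≰⇒> λ m≤u →
  <⇒≱ (<-≤-trans (m<m+n (u * (u + m)) 1≤t) h) (*-mono-≤ m≤u (m≤n+m m u))

Below-far : ∀ k → t ≤ suc (a + k) → Below t a (suc (a + a + k))
Below-far {t} {a} k t≤1+a+k = below (begin
  a * (a + M) + t                    ≤⟨ +-monoʳ-≤ (a * (a + M)) t≤1+a+k ⟩
  a * (a + M) + suc (a + k)          ≤⟨ m≤m+n _ _ ⟩
  a * (a + M) + suc (a + k) + slack  ≡⟨ identity a k ⟨
  M * M                              ∎)
  where
  open ≤-Reasoning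
  M = suc (a + a + k)
  slack = a * a + 3 * a * k + k * k + 2 * a + k
  identity : ∀ a k → suc (a + a + k) * suc (a + a + k)
                   ≡ a * (a + suc (a + a + k)) + suc (a + k) + (a * a + 3 * a * k + k * k + 2 * a + k)
  identity = solve-∀

¬Below⇒≤ : ∀ k → t ≤ suc (a + k) → ¬ Below t a m → m ≤ a + a + k
¬Below⇒≤ {t} {a} {m} k t≤1+a+k ¬a-below = ≮⇒≥ λ a+a+k<m →
  let d , m≡ = m≤n⇒∃[o]m+o≡n a+a+k<m in
  ¬a-below (subst (Below t a) (trans (cong suc (sym (+-assoc (a + a) k d))) m≡)
                  (Below-far (k + d) (≤-trans t≤1+a+k (s≤s (+-monoʳ-≤ a (m≤m+n k d))))))

Below-suc : 1 ≤ t → Below t u m → Below (suc t) u (suc m)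
Below-suc {t} {u} {m} 1≤t u-below@(below h) = below (begin
  u * (u + suc m) + suc t    ≡⟨ identity₁ u m t ⟩
  u * (u + m) + t + suc u    ≤⟨ +-mono-≤ h (Below⇒< 1≤t u-below) ⟩
  m * m + m                  ≤⟨ m≤m+n _ (suc m) ⟩
  m * m + m + suc m          ≡⟨ identity₂ m ⟩
  suc m * suc m              ∎)
  where
  open ≤-Reasoning
  identity₁ : ∀ u m t → u * (u + suc m) + suc t ≡ u * (u + m) + t + suc u
  identity₁ = solve-∀
  identity₂ : ∀ m → m * m + m + suc m ≡ suc m * suc m
  identity₂ = solve-∀

¬Below-suc : t ≤ 2 → ¬ Below t a m → ¬ Below t (suc a) (suc m)
¬Below-suc {t} {a} {m} t≤2 ¬a-below (below h) = <⇒≱ (begin-strict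
  suc m * suc m                               ≡⟨ identity₁ m ⟩
  m * m + (m + suc m)                         <⟨ +-mono-<-≤ (≰⇒> (¬a-below ∘ below))
                                                              (+-monoʳ-≤ m (s≤s m≤2a+1)) ⟩
  a * (a + m) + t + (m + suc (a + a + 1))     ≤⟨ m≤m+n _ a ⟩
  a * (a + m) + t + (m + suc (a + a + 1)) + a ≡⟨ identity₂ a m t ⟩
  suc a * (suc a + suc m) + t                 ∎) h
  where
  open ≤-Reasoning
  m≤2a+1 : m ≤ a + a + 1
  m≤2a+1 = ¬Below⇒≤ 1 (≤-trans t≤2 (s≤s (m≤n+m 1 a))) ¬a-below
  identity₁ : ∀ m → suc m * suc m ≡ m * m + (m + suc m)
  identity₁ = solve-∀
  identity₂ : ∀ a m t → a * (a + m) + t + (m + suc (a + a + 1)) + a ≡ suc a * (suc a + suc m) + t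
  identity₂ = solve-∀

Below⇒4b≤3m : 1 ≤ t → Below t b m → 4 * b ≤ 3 * m
Below⇒4b≤3m {t} {b} {m} 1≤t (below h) = ≮⇒≥ λ 3m<4b → <-irrefl refl (begin-strict
  16 * (m * m)                              ≤⟨ m≤m+n _ _ ⟩
  16 * (m * m) + (5 * (m * m) + 10 * m + 1) ≡⟨ identity₁ m ⟩
  suc (3 * m) * (suc (3 * m) + 4 * m)       ≤⟨ *-mono-≤ 3m<4b (+-monoˡ-≤ (4 * m) 3m<4b) ⟩
  4 * b * (4 * b + 4 * m)                   ≡⟨ identity₂ b m ⟩
  16 * (b * (b + m))                        <⟨ *-monoʳ-< 16 (<-≤-trans (m<m+n _ 1≤t) h) ⟩
  16 * (m * m)                              ∎)
  where
  open ≤-Reasoning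
  identity₁ : ∀ m → 16 * (m * m) + (5 * (m * m) + 10 * m + 1) ≡ suc (3 * m) * (suc (3 * m) + 4 * m)
  identity₁ = solve-∀
  identity₂ : ∀ b m → 4 * b * (4 * b + 4 * m) ≡ 16 * (b * (b + m))
  identity₂ = solve-∀

Below-suc-suc : 1 ≤ t → Below t b m → Below (suc t) (suc b) (suc (suc m))
Below-suc-suc {t} {b} {m} 1≤t b-below@(below h) = below (begin
  suc b * (suc b + suc (suc m)) + suc t ≡⟨ identity₁ b m t ⟩
  b * (b + m) + t + (4 * b + m + 4)     ≤⟨ +-mono-≤ h (+-monoˡ-≤ 4 (+-monoˡ-≤ m 4b≤3m)) ⟩
  m * m + (3 * m + m + 4)               ≡⟨ identity₂ m ⟩
  suc (suc m) * suc (suc m)             ∎)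
  where
  open ≤-Reasoning
  4b≤3m = Below⇒4b≤3m 1≤t b-below
  identity₁ : ∀ b m t → suc b * (suc b + suc (suc m)) + suc t ≡ b * (b + m) + t + (4 * b + m + 4)
  identity₁ = solve-∀
  identity₂ : ∀ m → m * m + (3 * m + m + 4) ≡ suc (suc m) * suc (suc m)
  identity₂ = solve-∀

exchange : ∀ {p q r s} t → p + q ≡ r + s → p + t ≤ r → s + t ≤ q
exchange {p} {q} {r} {s} t p+q≡r+s p+t≤r = +-cancelʳ-≤ p (s + t) q (begin
  s + t + p    ≡⟨ +-assoc s t p ⟩
  s + (t + p)  ≡⟨ cong (s +_) (+-comm t p) ⟩
  s + (p + t)  ≤⟨ +-monoʳ-≤ s p+t≤r ⟩
  s + r        ≡⟨ +-comm s r ⟩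
  r + s        ≡⟨ p+q≡r+s ⟨
  p + q        ≡⟨ +-comm p q ⟩
  q + p        ∎)
  where open ≤-Reasoning

exchange⇔ : ∀ {p q r s} t → p + q ≡ r + s → (p + t ≤ r ⇔ s + t ≤ q)
exchange⇔ {p} {q} {r} {s} t p+q≡r+s =
  mk⇔ (exchange t p+q≡r+s) (exchange t (trans (+-comm s r) (trans (sym p+q≡r+s) (+-comm p q))))

-- Q(a, a + b) = −Q(b, a).
fib-identity : ∀ a b → b * (b + a) + a * (a + (a + b)) ≡ a * a + (a + b) * (a + b)
fib-identity = solve-∀

Below⇔Above-fib : Below t b a ⇔ Above t a (a + b)
Below⇔Above-fib {t} {b} {a} =
  mk⇔ (λ (below h) → above (Equivalence.to e h)) (λ (above h) → below (Equivalence.from e h))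
  where
  e = exchange⇔ t (fib-identity a b)

Below-fib⇔Above : Below t a (a + b) ⇔ Above t b a
Below-fib⇔Above {t} {a} {b} =
  mk⇔ (λ (below h) → above (Equivalence.to e h)) (λ (above h) → below (Equivalence.from e h))
  where
  e = exchange⇔ t (trans (+-comm (a * (a + (a + b))) (b * (b + a)))
                   (trans (fib-identity a b) (+-comm (a * a) ((a + b) * (a + b)))))

opaque
  threshold : ℕ → ℕ → ℕ
  threshold t m = search (λ u → not ⌊ below? t u m ⌋) (suc m) 0

  threshold-isLeast : 1 ≤ t → IsLeast (λ u → not ⌊ below? t u m ⌋) (threshold t m)
  threshold-isLeast {t} {m} 1≤t =
    search-isLeast _ ≤-refl (cong not (⌊⌋-false (below? t m m) (<-irrefl refl ∘ Below⇒< 1≤t)))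

Flat Jump : (ℕ → ℕ) → ℕ → Set
Flat N i = N (suc i) ≡ N i
Jump N i = N (suc i) ≡ suc (N i)

greedyTerm : (ℕ → ℕ) → ℕ → ℕ
greedyTerm N i = N i + (N (suc i) ∸ N i) * suc i

module _ (N : ℕ → ℕ) {i : ℕ} where

  greedyTerm-flat : Flat N i → greedyTerm N i ≡ N i
  greedyTerm-flat flat rewrite flat | n∸n≡0 (N i) = +-identityʳ (N i)

  greedyTerm-jump : Jump N i → greedyTerm N i ≡ N i + suc i
  greedyTerm-jump jump rewrite jump | m+n∸n≡m 1 (N i) = cong (N i +_) (+-identityʳ (suc i))

  greedyTerm-telescopes : Flat N i ⊎ Jump N i → i * N i + greedyTerm N i ≡ suc i * N (suc i)
  greedyTerm-telescopes (inj₁ flat) rewrite greedyTerm-flat flat | flat = +-comm (i * N i) (N i)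
  greedyTerm-telescopes (inj₂ jump) rewrite greedyTerm-jump jump | jump = identity i (N i)
    where
    identity : ∀ i x → i * x + (x + suc i) ≡ suc i * suc x
    identity = solve-∀

module ThresholdSequence (t : ℕ) (1≤t : 1 ≤ t) (t≤2 : t ≤ 2) where

  N : ℕ → ℕ
  N = threshold t

  <N⇒Below : u < N m → Below t u m
  <N⇒Below {u} {m} u<N = not⌊⌋-false (below? t u m) (proj₂ (threshold-isLeast 1≤t) u<N)

  ¬Below-N : ¬ Below t (N m) m
  ¬Below-N {m} = not⌊⌋-true (below? t (N m) m) (proj₁ (threshold-isLeast 1≤t))

  Below⇒<N : Below t u m → u < N m
  Below⇒<N u-below = ≰⇒> λ N≤u → ¬Below-N (Below-antitone N≤u u-below)

  ¬Below⇒N≤ : ¬ Below t u m → N m ≤ u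
  ¬Below⇒N≤ ¬u-below = ≮⇒≥ λ u<N → ¬u-below (<N⇒Below u<N)

  N≤ : N m ≤ m
  N≤ = ¬Below⇒N≤ λ m-below → <-irrefl refl (Below⇒< 1≤t m-below)

  N≤N-suc : N m ≤ N (suc m)
  N≤N-suc = ≮⇒≥ λ N[1+m]<N[m] →
    ¬Below-N (Below-weaken (n≤1+n t) (Below-suc 1≤t (<N⇒Below N[1+m]<N[m])))

  N-suc≤suc-N : N (suc m) ≤ suc (N m)
  N-suc≤suc-N = ¬Below⇒N≤ (¬Below-suc t≤2 ¬Below-N)

  N-mono : m ≤ n → N m ≤ N n
  N-mono {n = zero}  z≤n = ≤-refl
  N-mono {n = suc n} m≤1+n with m≤n⇒m<n∨m≡n m≤1+n
  ... | inj₁ m<1+n = ≤-trans (N-mono (≤-pred m<1+n)) N≤N-suc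
  ... | inj₂ refl  = ≤-refl

  -- Opaque, so that with-abstraction over it does not normalise the ring-solver proofs within.
  opaque
    flat-or-jump : ∀ i → Flat N i ⊎ Jump N i
    flat-or-jump i = a≤b≤1+a⇒b≡a∨b≡1+a N≤N-suc N-suc≤suc-N

  N<N-suc-suc : N m < N (suc (suc m))
  N<N-suc-suc {m} with N m in N[m]≡
  ... | zero  = Below⇒<N (below (≤-trans t≤2 (s≤s (s≤s z≤n))))
  ... | suc b = Below⇒<N (Below-weaken (n≤1+n t)
                  (Below-suc-suc 1≤t (<N⇒Below (subst (b <_) (sym N[m]≡) ≤-refl))))

  -- With X = N i, write i = X + j and X = j + y; the identity for Q carries the conditions
  -- at i and i + 2 over to j and j + 1.
  jump-witness : ∀ {i} → Jump N i → Jump N (suc i) → t ≤ suc (N i) →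
                 ∃[ j ] j ≤ i × Jump N j × N j + j ≡ N i
  jump-witness {i} jump-i jump-1+i t≤1+X = j , j≤i , jump-j , N[j]+j≡X
    where
    X = N i
    i≤X+X : i ≤ X + X
    i≤X+X = ≤-trans (¬Below⇒≤ 0 (≤-trans t≤1+X (s≤s (m≤m+n X 0))) ¬Below-N)
                    (≤-reflexive (+-identityʳ (X + X)))
    j = i ∸ X
    X+j≡i : X + j ≡ i
    X+j≡i = m+[n∸m]≡n N≤
    j≤X : j ≤ X
    j≤X = +-cancelˡ-≤ X j X (subst (_≤ X + X) (sym X+j≡i) i≤X+X)
    y = X ∸ j
    j+y≡X : j + y ≡ X
    j+y≡X = m+[n∸m]≡n j≤X
    ¬y-below-j : ¬ Below t y j
    ¬y-below-j y-below-j = ¬Below-N (subst (Below t X) X+j≡i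
      (Equivalence.from Below-fib⇔Above
        (subst (Above t j) j+y≡X (Equivalence.to Below⇔Above-fib y-below-j))))
    1+X-below-2+i : Below t (suc X) (suc X + suc j)
    1+X-below-2+i = subst (Below t (suc X)) (sym (cong suc (trans (+-suc X j) (cong suc X+j≡i))))
                          (<N⇒Below (subst (suc X <_) (sym (trans jump-1+i (cong suc jump-i))) ≤-refl))
    y-below-1+j : Below t y (suc j)
    y-below-1+j = Equivalence.from Below⇔Above-fib
      (subst (Above t (suc j)) (cong suc (sym j+y≡X)) (Equivalence.to Below-fib⇔Above 1+X-below-2+i))
    y<N[1+j] : y < N (suc j)
    y<N[1+j] = Below⇒<N y-below-1+j
    N[j]≡y : N j ≡ y
    N[j]≡y = ≤-antisym (¬Below⇒N≤ ¬y-below-j) (≤-pred (≤-trans y<N[1+j] N-suc≤suc-N))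
    jump-j : Jump N j
    jump-j = ≤-antisym N-suc≤suc-N (subst (λ x → suc x ≤ N (suc j)) (sym N[j]≡y) y<N[1+j])
    N[j]+j≡X : N j + j ≡ X
    N[j]+j≡X = trans (cong (_+ j) N[j]≡y) (trans (+-comm y j) j+y≡X)
    j≤i : j ≤ i
    j≤i = subst (j ≤_) X+j≡i (m≤n+m j X)

  -- With X = N j + j and i = X + k, the identity for Q turns the conditions at j, j + 1, i
  -- and i + 1 into j < k < j + 1.
  jump-flat-apart : ∀ {i j} → Jump N j → Flat N i → N i ≢ N j + suc j
  jump-flat-apart {i} {j} jump-j flat-i N[i]≡ = <⇒≱ j<k (≤-pred k<1+j)
    where
    y = N j
    X = y + j
    N[i]≡1+X : N i ≡ suc X
    N[i]≡1+X = trans N[i]≡ (+-suc y j)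
    X≤i : X ≤ i
    X≤i = ≤-trans (n≤1+n X) (subst (_≤ i) N[i]≡1+X N≤)
    k = i ∸ X
    X+k≡i : X + k ≡ i
    X+k≡i = m+[n∸m]≡n X≤i
    above-1+j : Above t (suc j) (suc X)
    above-1+j = subst (Above t (suc j)) (cong suc (+-comm j y))
      (Equivalence.to Below⇔Above-fib (<N⇒Below (subst (y <_) (sym jump-j) ≤-refl)))
    ¬above-j : ¬ Above t j X
    ¬above-j above-j = ¬Below-N (Equivalence.from Below⇔Above-fib (subst (Above t j) (+-comm y j) above-j))
    above-k : Above t k X
    above-k = Equivalence.to Below-fib⇔Above
      (subst (Below t X) (sym X+k≡i) (<N⇒Below (subst (X <_) (sym N[i]≡1+X) ≤-refl)))
    ¬above-k : ¬ Above t k (suc X)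
    ¬above-k above-k′ = ¬Below-N (subst₂ (Below t) (sym (trans flat-i N[i]≡1+X)) (cong suc X+k≡i)
      (Equivalence.from Below-fib⇔Above above-k′))
    k<1+j : k < suc j
    k<1+j = ≰⇒> λ 1+j≤k → ¬above-k (Above-mono 1+j≤k above-1+j)
    j<k : j < k
    j<k = ≰⇒> λ k≤j → ¬above-j (Above-mono k≤j above-k)

  flat-not-taken : ∀ {i j} → Flat N i → j < i → greedyTerm N j ≢ N i
  flat-not-taken {i} {j} flat-i j<i with flat-or-jump j
  ... | inj₁ flat-j = λ g≡N[i] → <⇒≢ N[j]<N[i] (trans (sym (greedyTerm-flat N flat-j)) g≡N[i])
    where
    N[j]<N[i] : N j < N i
    N[j]<N[i] = <-≤-trans N<N-suc-suc (≤-trans (N-mono (s≤s j<i)) (≤-reflexive flat-i))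
  ... | inj₂ jump-j = λ g≡N[i] →
    jump-flat-apart jump-j flat-i (trans (sym g≡N[i]) (greedyTerm-jump N jump-j))

  jump-taken : ∀ {i} → Jump N (suc i) → t ≤ suc (N i) →
               ∃[ j ] j ≤ i × greedyTerm N j ≡ N (suc i)
  jump-taken {i} jump-1+i t≤1+N[i] with flat-or-jump i
  ... | inj₁ flat-i = i , ≤-refl , trans (greedyTerm-flat N flat-i) (sym flat-i)
  ... | inj₂ jump-i =
    let j , j≤i , jump-j , N[j]+j≡N[i] = jump-witness jump-i jump-1+i t≤1+N[i] in
    j , j≤i , (begin
      greedyTerm N j  ≡⟨ greedyTerm-jump N jump-j ⟩
      N j + suc j     ≡⟨ +-suc (N j) j ⟩
      suc (N j + j)   ≡⟨ cong suc N[j]+j≡N[i] ⟩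
      suc (N i)       ≡⟨ jump-i ⟨
      N (suc i)       ∎)
    where open ≡-Reasoning

  greedyTerm-≤ : ∀ {i j} → j < i → greedyTerm N j ≤ N i + i
  greedyTerm-≤ {i} {j} j<i with flat-or-jump j
  ... | inj₁ flat-j =
    subst (_≤ N i + i) (sym (greedyTerm-flat N flat-j)) (≤-trans (N-mono (<⇒≤ j<i)) (m≤m+n (N i) i))
  ... | inj₂ jump-j =
    subst (_≤ N i + i) (sym (greedyTerm-jump N jump-j)) (+-mono-≤ (N-mono (<⇒≤ j<i)) j<i)

  N-suc≤greedyTerm : ∀ {i} → N (suc i) ≤ greedyTerm N i
  N-suc≤greedyTerm {i} with flat-or-jump i
  ... | inj₁ flat-i = ≤-reflexive (trans flat-i (sym (greedyTerm-flat N flat-i)))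
  ... | inj₂ jump-i = subst₂ _≤_ (sym jump-i) (sym (greedyTerm-jump N jump-i)) (m<m+n (N i) z<s)

drop-++ : ∀ k (xs ys : List ℕ) → k ≤ length xs → drop k (xs ++ ys) ≡ drop k xs ++ ys
drop-++ zero    xs       ys _         = refl
drop-++ (suc k) (x ∷ xs) ys (s≤s k≤n) = drop-++ k xs ys k≤n

history : (ℕ → ℕ) → ℕ → List ℕ
history g zero    = []
history g (suc n) = history g n ++ [ g n ]

module _ {g : ℕ → ℕ} where

  ∈-history⁺ : ∀ {j n} → j < n → g j ∈ history g n
  ∈-history⁺ {j} {suc n} j<1+n with m<1+n⇒m<n∨m≡n j<1+n
  ... | inj₁ j<n  = ∈-++⁺ˡ (∈-history⁺ j<n)
  ... | inj₂ refl = ∈-++⁺ʳ (history g j) (here refl)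

  ∈-history⁻ : ∀ {x n} → x ∈ history g n → ∃[ j ] j < n × g j ≡ x
  ∈-history⁻ {n = suc n} x∈ with ∈-++⁻ (history g n) x∈
  ... | inj₁ x∈′ = let j , j<n , g[j]≡x = ∈-history⁻ x∈′ in j , m<n⇒m<1+n j<n , g[j]≡x
  ... | inj₂ (here x≡g[n]) = n , ≤-refl , sym x≡g[n]

  length-history : ∀ n → length (history g n) ≡ n
  length-history zero    = refl
  length-history (suc n) =
    trans (length-++ (history g n)) (trans (cong (_+ 1) (length-history n)) (+-comm n 1))

  sum-drop-history-suc : ∀ k n → k ≤ n →
                         sum (drop k (history g (suc n))) ≡ sum (drop k (history g n)) + g n
  sum-drop-history-suc k n k≤n = begin
    sum (drop k (history g n ++ [ g n ]))   ≡⟨ cong sum (drop-++ k (history g n) [ g n ] k≤length) ⟩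
    sum (drop k (history g n) ++ [ g n ])   ≡⟨ sum-++ (drop k (history g n)) [ g n ] ⟩
    sum (drop k (history g n)) + (g n + 0)  ≡⟨ cong (sum (drop k (history g n)) +_) (+-identityʳ (g n)) ⟩
    sum (drop k (history g n)) + g n        ∎
    where
    open ≡-Reasoning
    k≤length = subst (k ≤_) (sym (length-history n)) k≤n

module T₁ = ThresholdSequence 1 ≤-refl (s≤s z≤n)
module T₂ = ThresholdSequence 2 (s≤s z≤n) ≤-refl

F : ℕ → ℕ
F zero    = 0
F (suc k) = greedyTerm T₁.N k

T₁-pos : ∀ k → 0 < T₁.N (suc k)
T₁-pos k = T₁.Below⇒<N (below (s≤s z≤n))

sum-F : ∀ k → sum (history F (suc k)) ≡ k * T₁.N k
sum-F zero    = refl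
sum-F (suc k) = begin
  sum (history F (suc (suc k)))        ≡⟨ sum-drop-history-suc 0 (suc k) z≤n ⟩
  sum (history F (suc k)) + F (suc k)  ≡⟨ cong (_+ F (suc k)) (sum-F k) ⟩
  k * T₁.N k + greedyTerm T₁.N k       ≡⟨ greedyTerm-telescopes T₁.N (T₁.flat-or-jump k) ⟩
  suc k * T₁.N (suc k)                 ∎
  where open ≡-Reasoning

F≤ : ∀ {j k} → j ≤ k → F j ≤ T₁.N k + k
F≤ {zero}  _   = z≤n
F≤ {suc j} j<k = T₁.greedyTerm-≤ j<k

flat⇒F-fresh : ∀ {k} → Flat T₁.N k → T₁.N k ∉ history F (suc k)
flat⇒F-fresh {k} flat N[k]∈ with ∈-history⁻ N[k]∈
... | zero  , _       , 0≡N[k]  = <⇒≢ (subst (0 <_) flat (T₁-pos k)) 0≡N[k]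
... | suc j , 1+j<1+k , F[1+j]≡ = T₁.flat-not-taken flat (≤-pred 1+j<1+k) F[1+j]≡

jump⇒F-taken : ∀ {k} → Jump T₁.N k → T₁.N k ∈ history F (suc k)
jump⇒F-taken {zero}  _    = here (n≤0⇒n≡0 T₁.N≤)
jump⇒F-taken {suc i} jump =
  let j , j≤i , F[1+j]≡ = T₁.jump-taken jump (s≤s z≤n) in
  subst (_∈ history F (suc (suc i))) F[1+j]≡ (∈-history⁺ {j = suc j} (s≤s (s≤s j≤i)))

F-new : ∀ k → T₁.N k + suc k ∉ history F (suc k)
F-new k x∈ =
  let j , j<1+k , F[j]≡ = ∈-history⁻ x∈ in
  <⇒≢ (≤-<-trans (F≤ (≤-pred j<1+k)) (+-monoʳ-< (T₁.N k) ≤-refl)) F[j]≡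

fNext-history : ∀ n → fNext n (history F n) ≡ F n
fNext-history zero    = refl
fNext-history (suc k) = step (T₁.flat-or-jump k)
  where
  open Greedy (sum-F k) T₁.N≤ (bound-large T₁.N≤ (n≤1+n k))
  step : Flat T₁.N k ⊎ Jump T₁.N k → fNext (suc k) (history F (suc k)) ≡ F (suc k)
  step (inj₁ flat) = trans (greedy-fresh (flat⇒F-fresh flat)) (sym (greedyTerm-flat T₁.N flat))
  step (inj₂ jump) = trans (greedy-taken (jump⇒F-taken jump) (F-new k)) (sym (greedyTerm-jump T₁.N jump))

fHist≡history : ∀ n → fHist n ≡ history F n
f≡F : ∀ n → f n ≡ F n

fHist≡history zero    = refl
fHist≡history (suc n) = cong₂ (λ L x → L ++ [ x ]) (fHist≡history n) (f≡F n)

f≡F n = trans (cong (fNext n) (fHist≡history n)) (fNext-history n)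

-- z(n) + 1 = greedyTerm T₂.N n for n ≥ 1, while z(0) = 0 = pred 0.
Z : ℕ → ℕ
Z n = pred (greedyTerm T₂.N n)

T₂-pos : ∀ k → 0 < T₂.N (2 + k)
T₂-pos k = T₂.Below⇒<N (below (s≤s (s≤s z≤n)))

pred-T₂≤ : pred (T₂.N n) ≤ n
pred-T₂≤ = ≤-trans pred[n]≤n T₂.N≤

T₂-1 : T₂.N 1 ≡ 0
T₂-1 = n≤0⇒n≡0 (T₂.¬Below⇒N≤ (from-no (below? 2 0 1)))

T₂-2 : T₂.N 2 ≡ 1
T₂-2 = ≤-antisym (T₂.¬Below⇒N≤ (from-no (below? 2 1 2))) (T₂.Below⇒<N (from-yes (below? 2 0 2)))

2≤T₂-3 : 2 ≤ T₂.N 3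
2≤T₂-3 = T₂.Below⇒<N (from-yes (below? 2 1 3))

Z-0 : Z 0 ≡ 0
Z-0 = cong pred (trans (greedyTerm-flat T₂.N (trans T₂-1 (sym T₂-0))) T₂-0)
  where
  T₂-0 : T₂.N 0 ≡ 0
  T₂-0 = n≤0⇒n≡0 T₂.N≤

Z-1 : Z 1 ≡ 1
Z-1 = cong pred (trans (greedyTerm-jump T₂.N (trans T₂-2 (cong suc (sym T₂-1)))) (cong (_+ 2) T₂-1))

Z-flat : ∀ {n} → Flat T₂.N n → Z n ≡ pred (T₂.N n)
Z-flat flat = cong pred (greedyTerm-flat T₂.N flat)

Z-jump : ∀ {n} → Jump T₂.N n → Z n ≡ T₂.N n + n
Z-jump {n} jump = cong pred (trans (greedyTerm-jump T₂.N jump) (+-suc (T₂.N n) n))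

pred+suc : ∀ n → 0 < x → pred x + suc n ≡ x + n
pred+suc {suc y} n _ = +-suc y n

Z-telescopes : ∀ {n} → 0 < T₂.N n → n * pred (T₂.N n) + Z n ≡ suc n * pred (T₂.N (suc n))
Z-telescopes {n} 0<D with T₂.flat-or-jump n
... | inj₁ flat rewrite Z-flat flat | flat = +-comm (n * pred (T₂.N n)) (pred (T₂.N n))
... | inj₂ jump rewrite Z-jump jump | jump = identity n (T₂.N n) 0<D
  where
  ring-identity : ∀ n y → n * y + (suc y + n) ≡ suc n * suc y
  ring-identity = solve-∀
  identity : ∀ n x → 0 < x → n * pred x + (x + n) ≡ suc n * x
  identity n (suc y) _ = ring-identity n y

sum-Z : ∀ k → sum (drop 2 (history Z (2 + k))) ≡ (2 + k) * pred (T₂.N (2 + k))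
sum-Z zero    = cong (λ x → 2 * pred x) (sym T₂-2)
sum-Z (suc k) = begin
  sum (drop 2 (history Z (3 + k)))              ≡⟨ sum-drop-history-suc 2 (2 + k) (s≤s (s≤s z≤n)) ⟩
  sum (drop 2 (history Z (2 + k))) + Z (2 + k)  ≡⟨ cong (_+ Z (2 + k)) (sum-Z k) ⟩
  (2 + k) * pred (T₂.N (2 + k)) + Z (2 + k)     ≡⟨ Z-telescopes (T₂-pos k) ⟩
  (3 + k) * pred (T₂.N (3 + k))                 ∎
  where open ≡-Reasoning

flat⇒Z-fresh : ∀ k → Flat T₂.N (2 + k) → pred (T₂.N (2 + k)) ∉ history Z (2 + k)
flat⇒Z-fresh k flat x∈ with ∈-history⁻ x∈
... | zero  , _       , Z[0]≡ =
  <-irrefl (sym D[3+k]≡1) (≤-trans 2≤T₂-3 (T₂.N-mono (s≤s (s≤s (s≤s z≤n)))))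
  where
  D[3+k]≡1 : T₂.N (3 + k) ≡ 1
  D[3+k]≡1 = trans flat (trans (sym (suc-pred _ {{>-nonZero (T₂-pos k)}}))
                               (cong suc (trans (sym Z[0]≡) Z-0)))
... | suc j , 1+j<2+k , Z[1+j]≡ = T₂.flat-not-taken flat 1+j<2+k
  (pred-injective {{>-nonZero (<-≤-trans (T₂-pos j) T₂.N-suc≤greedyTerm)}} {{>-nonZero (T₂-pos k)}}
                  Z[1+j]≡)

jump⇒Z-taken : ∀ k → Jump T₂.N (2 + k) → pred (T₂.N (2 + k)) ∈ history Z (2 + k)
jump⇒Z-taken zero    _    = here (trans (cong pred T₂-2) (sym Z-0))
jump⇒Z-taken (suc k) jump =
  let j , j≤2+k , g[j]≡ = T₂.jump-taken jump (s≤s (T₂-pos k)) in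
  subst (_∈ history Z (3 + k)) (cong pred g[j]≡) (∈-history⁺ (s≤s j≤2+k))

Z-new : ∀ k → pred (T₂.N (2 + k)) + (3 + k) ∉ history Z (2 + k)
Z-new k x∈ =
  let j , j<2+k , Z[j]≡ = ∈-history⁻ x∈ in
  <⇒≢ (begin-strict
    Z j                             ≤⟨ pred-mono-≤ (T₂.greedyTerm-≤ j<2+k) ⟩
    pred (T₂.N (2 + k) + (2 + k))   <⟨ ≤-reflexive (suc-pred _ {{>-nonZero 0<D+n}}) ⟩
    T₂.N (2 + k) + (2 + k)          ≡⟨ pred+suc (2 + k) (T₂-pos k) ⟨
    pred (T₂.N (2 + k)) + (3 + k)   ∎) Z[j]≡
  where
  open ≤-Reasoning
  0<D+n = ≤-trans (T₂-pos k) (m≤m+n _ (2 + k))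

zNext-history : ∀ n → zNext n (history Z n) ≡ Z n
zNext-history zero          = sym Z-0
zNext-history (suc zero)    = trans (cong (λ x → zNext 1 [ x ]) Z-0) (sym Z-1)
zNext-history (suc (suc k)) = step (T₂.flat-or-jump (2 + k))
  where
  open Greedy (sum-Z k) pred-T₂≤ (bound-large pred-T₂≤ ≤-refl)
  step : Flat T₂.N (2 + k) ⊎ Jump T₂.N (2 + k) → zNext (2 + k) (history Z (2 + k)) ≡ Z (2 + k)
  step (inj₁ flat) = trans (greedy-fresh (flat⇒Z-fresh k flat)) (sym (Z-flat flat))
  step (inj₂ jump) = trans (greedy-taken (jump⇒Z-taken k jump) (Z-new k))
                           (sym (trans (Z-jump jump) (sym (pred+suc (2 + k) (T₂-pos k)))))

zHist≡history : ∀ n → zHist n ≡ history Z n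
z≡Z : ∀ n → z n ≡ Z n

zHist≡history zero    = refl
zHist≡history (suc n) = cong₂ (λ L x → L ++ [ x ]) (zHist≡history n) (z≡Z n)

z≡Z n = trans (cong (zNext n) (zHist≡history n)) (zNext-history n)

T₁≤T₂-suc : T₁.N m ≤ T₂.N (suc m)
T₁≤T₂-suc = ≮⇒≥ λ T₂<T₁ → T₂.¬Below-N (Below-suc ≤-refl (T₁.<N⇒Below T₂<T₁))

T₂-suc≤suc-T₁ : T₂.N (suc m) ≤ suc (T₁.N m)
T₂-suc≤suc-T₁ = T₂.¬Below⇒N≤ (¬Below-suc (s≤s z≤n) T₁.¬Below-N ∘ Below-weaken (n≤1+n 1))

T₁<T₂-suc-suc : T₁.N m < T₂.N (suc (suc m))
T₁<T₂-suc-suc {m} with T₁.N m in N[m]≡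
... | zero  = T₂.Below⇒<N (below (s≤s (s≤s z≤n)))
... | suc b = T₂.Below⇒<N (Below-suc-suc ≤-refl (T₁.<N⇒Below (subst (b <_) (sym N[m]≡) ≤-refl)))

Close : ℕ → ℕ → ℕ → Set
Close n x y = x ≡ y ⊎ x ≡ y + n ⊎ x ≡ y + 1 ⊎ x + n ≡ y

Z-close-to-F : ∀ m → Close (suc m) (Z (suc m)) (F (suc m))
Z-close-to-F m = cases (T₂.flat-or-jump (suc m)) (T₁.flat-or-jump m)
                       (a≤b≤1+a⇒b≡a∨b≡1+a T₁≤T₂-suc T₂-suc≤suc-T₁)
  where
  c = T₁.N m
  cases : Flat T₂.N (suc m) ⊎ Jump T₂.N (suc m) → Flat T₁.N m ⊎ Jump T₁.N m →
          T₂.N (suc m) ≡ c ⊎ T₂.N (suc m) ≡ suc c → Close (suc m) (Z (suc m)) (F (suc m))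
  cases (inj₁ flat₂) (inj₁ flat₁) (inj₂ D≡1+c) =
    inj₁ (trans (Z-flat flat₂) (trans (cong pred D≡1+c) (sym (greedyTerm-flat T₁.N flat₁))))
  cases (inj₁ flat₂) (inj₂ jump₁) (inj₂ D≡1+c) =
    inj₂ (inj₂ (inj₂ (trans (cong (_+ suc m) (trans (Z-flat flat₂) (cong pred D≡1+c)))
                            (sym (greedyTerm-jump T₁.N jump₁)))))
  cases (inj₁ flat₂) _            (inj₁ D≡c)   =
    contradiction (trans flat₂ D≡c) (<⇒≢ (T₁<T₂-suc-suc {m}) ∘ sym)
  cases (inj₂ jump₂) (inj₁ flat₁) (inj₁ D≡c)   =
    inj₂ (inj₁ (trans (Z-jump jump₂) (cong (_+ suc m) (trans D≡c (sym (greedyTerm-flat T₁.N flat₁))))))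
  cases (inj₂ jump₂) (inj₂ jump₁) (inj₁ D≡c)   =
    inj₁ (trans (Z-jump jump₂) (trans (cong (_+ suc m) D≡c) (sym (greedyTerm-jump T₁.N jump₁))))
  cases (inj₂ jump₂) (inj₁ flat₁) (inj₂ D≡1+c) =
    contradiction (T₂-suc≤suc-T₁ {suc m})
                  (1+n≰n ∘ subst₂ _≤_ (trans jump₂ (cong suc D≡1+c)) (cong suc flat₁))
  cases (inj₂ jump₂) (inj₂ jump₁) (inj₂ D≡1+c) =
    inj₂ (inj₂ (inj₁ (trans (Z-jump jump₂) (trans (cong (_+ suc m) D≡1+c)
      (trans (+-comm 1 (c + suc m)) (cong (_+ 1) (sym (greedyTerm-jump T₁.N jump₁))))))))

theorem6 : (n : ℕ) → z n ≡ f n ⊎ z n ≡ f n + n ⊎ z n ≡ f n + 1 ⊎ z n + n ≡ f n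
theorem6 zero    = inj₁ refl
theorem6 (suc m) = subst₂ (Close (suc m)) (sym (z≡Z (suc m))) (sym (f≡F (suc m))) (Z-close-to-F m)
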